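{- $\mathfrak{ss}_c\leq\min\{\mathfrak{ss}_{cc},\mathfrak{ss}_{ac}\}$ and $\mathfrak{ss}_c^\perp\geq\max\{\mathfrak{ss}_{cc}^\perp,\mathfrak{ss}_{ac}^\perp\}$.
   Context: Let $\mathfrak S$ be the set of sequences $\boldsymbol a=\langle a_i:i\in\omega\rangle$ of rational numbers with $a_i\to 0$. For infinite $X\subseteq\omega$ with increasing enumeration $\langle i_n:n\in\omega\rangle$, $\sum_X\boldsymbol a$ denotes the series $\sum_{n}a_{i_n}$. A series is convergent if its partial sums converge to a real number. A series is conditional if the sum of its positive terms is $+\infty$ and the sum of its negative terms is $-\infty$; it is conditionally convergent if convergent and conditional, absolutely convergent if convergent and not conditional. Let $\mathfrak S_{cc}$ be the set of $\boldsymbol a\in\mathfrak S$ with $\sum_\omega\boldsymbol a$ conditionally convergent, and $[\omega]^\omega_\omega$ the set of infinite coinfinite subsets of $\omega$. For a property $P\in\{$convergent, conditionally convergent, absolutely convergent$\}$ (subscripts $c$, $cc$, $ac$ respectively), $\mathfrak{ss}_P$ is the least cardinality of $\mathcal X\subseteq[\omega]^\omega_\omega$ such that for every $\boldsymbol a\in\mathfrak S_{cc}$ there is $X\in\mathcal X$ with $\sum_X\boldsymbol a$ having property $P$, and $\mathfrak{ss}_P^\perp$ is the least cardinality of $\mathcal A\subseteq\mathfrak S_{cc}$ such that no $X\in[\omega]^\omega_\omega$ makes $\sum_X\boldsymbol a$ have property $P$ for all $\boldsymbol a\in\mathcal A$. -}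

module Defs where

open import Data.Nat using (ℕ; zero; suc; _≥_)
open import Data.Bool using (Bool; true; false; if_then_else_)
open import Data.Rational using (ℚ; 0ℚ; _+_; _-_; _<_; _≤_; _⊔_; _⊓_; ∣_∣; -_; Positive)
open import Data.Product using (Σ; ∃; ∃-syntax; _×_)
open import Relation.Nullary using (¬_)
open import Relation.Binary.PropositionalEquality using (_≡_)
open import Function.Bundles using (_↣_)

Seq : Set
Seq = ℕ → ℚ

TendsToZero : Seq → Set
TendsToZero a = ∀ (ε : ℚ) → Positive ε → ∃[ N ] ∀ n → n ≥ N → ∣ a n ∣ < ε

Subset : Set
Subset = ℕ → Bool

Infinite : Subset → Set
Infinite X = ∀ n → ∃[ m ] (m ≥ n × X m ≡ true)

Coinfinite : Subset → Set
Coinfinite X = ∀ n → ∃[ m ] (m ≥ n × X m ≡ false)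

record ICSubset : Set where
  field
    set   : Subset
    inf   : Infinite set
    coinf : Coinfinite set
open ICSubset public

ω : Subset
ω _ = true

psum : (ℚ → ℚ) → Subset → Seq → ℕ → ℚ
psum f X a zero    = 0ℚ
psum f X a (suc k) = psum f X a k + (if X k then f (a k) else 0ℚ)

idℚ : ℚ → ℚ
idℚ q = q

posPart : ℚ → ℚ
posPart q = q ⊔ 0ℚ

negPart : ℚ → ℚ
negPart q = q ⊓ 0ℚ

-- Σ_X a converges (to a real number): its partial sums are Cauchy
Convergent : Subset → Seq → Set
Convergent X a = ∀ (ε : ℚ) → Positive ε → ∃[ N ] ∀ m n → m ≥ N → n ≥ N →
                   ∣ psum idℚ X a m - psum idℚ X a n ∣ < ε

Conditional : Subset → Seq → Set
Conditional X a = (∀ (B : ℚ) → ∃[ k ] B < psum posPart X a k)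
                × (∀ (B : ℚ) → ∃[ k ] psum negPart X a k < B)

CondConvergent : Subset → Seq → Set
CondConvergent X a = Convergent X a × Conditional X a

AbsConvergent : Subset → Seq → Set
AbsConvergent X a = Convergent X a × ¬ Conditional X a

record SCC : Set where
  field
    seq   : Seq
    null  : TendsToZero seq
    ccω   : CondConvergent ω seq
open SCC public

Property : Set₁
Property = Subset → Seq → Set

-- 𝒳 (indexed by I) witnesses 𝔰𝔰_P : every a ∈ 𝔖_cc has some X ∈ 𝒳 with Σ_X a having P
SSFamily : Property → (I : Set) → (I → ICSubset) → Set
SSFamily P I 𝒳 = ∀ (a : SCC) → ∃[ i ] P (set (𝒳 i)) (seq a)

-- 𝒜 (indexed by I) witnesses 𝔰𝔰_P^⊥ : no X ∈ [ω]^ω_ω makes Σ_X a have P for all a ∈ 𝒜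
SSPerpFamily : Property → (I : Set) → (I → SCC) → Set
SSPerpFamily P I 𝒜 = ¬ (Σ ICSubset λ X → ∀ (i : I) → P (set X) (seq (𝒜 i)))

-- 𝔰𝔰_P ≤ 𝔰𝔰_Q  (cardinal comparison of the least sizes of witnessing families):
-- every Q-witnessing family has a P-witnessing family of no larger cardinality
SS≤ : Property → Property → Set₁
SS≤ P Q = ∀ (I : Set) (𝒳 : I → ICSubset) → SSFamily Q I 𝒳 →
          Σ Set λ J → Σ (J → ICSubset) λ 𝒴 → SSFamily P J 𝒴 × (J ↣ I)

-- 𝔰𝔰_P^⊥ ≥ 𝔰𝔰_Q^⊥ : every P-perp-witnessing family has a Q-perp-witnessing
-- family of no larger cardinality
SSPerp≥ : Property → Property → Set₁
SSPerp≥ P Q = ∀ (I : Set) (𝒜 : I → SCC) → SSPerpFamily P I 𝒜 →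
              Σ Set λ J → Σ (J → SCC) λ ℬ → SSPerpFamily Q J ℬ × (J ↣ I)

{-# OPTIONS --safe #-}
-- Conditional and absolute convergence both imply convergence, and weakening the
-- property can only shrink 𝔰𝔰 and enlarge 𝔰𝔰^⊥: the very same family is a witness,
-- with the identity as the injection.
module Submission where

open import Defs
open import Data.Product using (_×_; _,_; map₂; proj₁)
open import Function.Construct.Identity using (↣-id)
open import Relation.Binary.Core using (_⇒_)

⇒-SS≤ : ∀ {P Q : Property} → Q ⇒ P → SS≤ P Q
⇒-SS≤ Q⇒P I 𝒳 𝒳-witnesses = I , 𝒳 , (λ a → map₂ Q⇒P (𝒳-witnesses a)) , ↣-id I

⇒-SSPerp≥ : ∀ {P Q : Property} → Q ⇒ P → SSPerp≥ P Q
⇒-SSPerp≥ Q⇒P I 𝒜 𝒜-witnesses =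
  I , 𝒜 , (λ (X , Q-everywhere) → 𝒜-witnesses (X , λ i → Q⇒P (Q-everywhere i))) , ↣-id I

condConvergent⇒convergent : CondConvergent ⇒ Convergent
condConvergent⇒convergent = proj₁

absConvergent⇒convergent : AbsConvergent ⇒ Convergent
absConvergent⇒convergent = proj₁

mainTheorem5 : (SS≤ Convergent CondConvergent × SS≤ Convergent AbsConvergent)
             × (SSPerp≥ Convergent CondConvergent × SSPerp≥ Convergent AbsConvergent)
mainTheorem5 =
    ( ⇒-SS≤ {Q = CondConvergent} condConvergent⇒convergent
    , ⇒-SS≤ {Q = AbsConvergent} absConvergent⇒convergent )
  , ( ⇒-SSPerp≥ {Q = CondConvergent} condConvergent⇒convergent
    , ⇒-SSPerp≥ {Q = AbsConvergent} absConvergent⇒convergent )
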